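{- Let $n\ge 1$ and $t$ be a positive integer with $t\le n/2$, and let $G$ be the star graph with vertex set $\{1,\dots,n+1\}$ and edges $\{n+1,i\}$ for $i=1,\dots,n$. Then the Halperin–Srinivasan SDP relaxation of unweighted $t$-Partial-Vertex-Cover has integrality gap at least $n/t$ on $G$; that is, the minimum size of a $t$-partial vertex cover of $G$ divided by the optimal value of the SDP on $G$ is at least $n/t$.
   Context: For a graph $G=(V,E)$ and integer $t\le|E|$, a $t$-partial vertex cover is a set $S\subseteq V$ such that at least $t$ edges have an endpoint in $S$. The Halperin–Srinivasan SDP is: minimize $\frac12\sum_{i\in V}(1+\mathbf v_0\cdot\mathbf v_i)$ over unit vectors $\mathbf v_i\in\mathbb R^{|V|}$, $i\in V\cup\{0\}$, subject to, for every edge $\{i,j\}\in E$: $\mathbf v_0\cdot\mathbf v_i+\mathbf v_0\cdot\mathbf v_j-\mathbf v_i\cdot\mathbf v_j\le 1$ and $\mathbf v_0\cdot\mathbf v_i+\mathbf v_0\cdot\mathbf v_j+\mathbf v_i\cdot\mathbf v_j\ge -1$; and $\sum_{\{i,j\}\in E}(3+\mathbf v_0\cdot\mathbf v_i+\mathbf v_0\cdot\mathbf v_j-\mathbf v_i\cdot\mathbf v_j)\ge 4t$. -}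

module Defs where

open import Level using (0ℓ)
open import Data.Nat as ℕ using (ℕ; zero; suc)
open import Data.Fin using (Fin; fromℕ; inject₁)
open import Data.Bool using (Bool; true; false; _∨_)
open import Data.Vec using (lookup)
open import Data.Fin.Subset using (Subset; ∣_∣)
open import Data.Product using (Σ; ∃; _×_; _,_)
open import Relation.Binary.PropositionalEquality using (_≡_)
open import Relation.Binary.Structures using (IsTotalOrder)
open import Relation.Nullary using (¬_)
open import Algebra.Structures using (IsCommutativeRing)

record Graph : Set where
  field
    nV   : ℕ
    nE   : ℕ
    ends : Fin nE → Fin nV × Fin nV
open Graph public

countFin : (m : ℕ) → (Fin m → Bool) → ℕ
countFin zero    p = 0
countFin (suc m) p with p Fin.zero
... | true  = suc (countFin m (λ k → p (Fin.suc k)))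
... | false = countFin m (λ k → p (Fin.suc k))

hits : (G : Graph) → Subset (nV G) → Fin (nE G) → Bool
hits G S e with ends G e
... | (i , j) = lookup S i ∨ lookup S j

covered : (G : Graph) → Subset (nV G) → ℕ
covered G S = countFin (nE G) (hits G S)

IsPartialVC : (G : Graph) → ℕ → Subset (nV G) → Set
IsPartialVC G t S = t ℕ.≤ covered G S

IsMinPartialVC : (G : Graph) → ℕ → ℕ → Set
IsMinPartialVC G t m =
  (Σ (Subset (nV G)) λ S → IsPartialVC G t S × ∣ S ∣ ≡ m)
  × ((S : Subset (nV G)) → IsPartialVC G t S → m ℕ.≤ ∣ S ∣)

-- The star graph: vertices 1..n+1 are Fin (suc n) (vertex k ↦ index k-1),
-- the centre n+1 is  fromℕ n , and edge i (i = 1..n) is {n+1, i}.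
star : ℕ → Graph
star n = record { nV = suc n ; nE = n ; ends = λ i → (fromℕ n , inject₁ i) }

-- The real numbers, axiomatised as a (Dedekind-)complete ordered field.
-- All models are isomorphic to ℝ.  The field 'sqrt' is a consequence of
-- the other axioms (completeness), included only for convenience.

record RealField : Set₁ where
  infixl 6 _+_
  infixl 7 _*_
  infix  4 _≤_
  infixl 6 _-_
  field
    R     : Set
    _+_   : R → R → R
    _*_   : R → R → R
    -_    : R → R
    0#    : R
    1#    : R
    _≤_   : R → R → Set
    isCommutativeRing : IsCommutativeRing _≡_ _+_ _*_ -_ 0# 1#
    0≢1      : ¬ (0# ≡ 1#)
    inverse  : ∀ x → ¬ (x ≡ 0#) → ∃ λ y → x * y ≡ 1#
    isTotalOrder : IsTotalOrder _≡_ _≤_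
    +-mono-≤ : ∀ {x y} z → x ≤ y → x + z ≤ y + z
    *-nonneg : ∀ {x y} → 0# ≤ x → 0# ≤ y → 0# ≤ x * y
    complete : (P : R → Set) → (∃ λ x → P x) → (∃ λ b → ∀ x → P x → x ≤ b)
             → ∃ λ s → ((∀ x → P x → x ≤ s) × (∀ b → (∀ x → P x → x ≤ b) → s ≤ b))
    sqrt     : ∀ x → 0# ≤ x → ∃ λ y → y * y ≡ x

  _<_ : R → R → Set
  x < y = (x ≤ y) × ¬ (x ≡ y)

  _-_ : R → R → R
  x - y = x + (- y)

  fromℕ' : ℕ → R
  fromℕ' zero    = 0#
  fromℕ' (suc k) = 1# + fromℕ' k

  sumFin : (m : ℕ) → (Fin m → R) → R
  sumFin zero    f = 0#
  sumFin (suc m) f = f Fin.zero + sumFin m (λ k → f (Fin.suc k))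

  Vect : ℕ → Set
  Vect d = Fin d → R

  _·_ : ∀ {d} → Vect d → Vect d → R
  _·_ {d} u w = sumFin d (λ k → u k * w k)

  module _ (G : Graph) (t : ℕ) where

    record HSFeasible : Set where
      field
        v0 : Vect (nV G)
        v  : Fin (nV G) → Vect (nV G)
        unit0 : v0 · v0 ≡ 1#
        unit  : ∀ i → v i · v i ≡ 1#
        edge₁ : ∀ e → let (i , j) = ends G e in
                 (v0 · v i) + (v0 · v j) - (v i · v j) ≤ 1#
        edge₂ : ∀ e → let (i , j) = ends G e in
                 - 1# ≤ (v0 · v i) + (v0 · v j) + (v i · v j)
        demand : fromℕ' 4 * fromℕ' t ≤
                 sumFin (nE G) (λ e → let (i , j) = ends G e in
                   fromℕ' 3 + (v0 · v i) + (v0 · v j) - (v i · v j))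

      twiceObjective : R
      twiceObjective = sumFin (nV G) (λ i → 1# + (v0 · v i))

    HSValue : R → Set
    HSValue c = Σ HSFeasible λ s → fromℕ' 2 * c ≡ HSFeasible.twiceObjective s

    IsHSOpt : R → Set
    IsHSOpt opt = (∀ c → HSValue c → opt ≤ c)
                × (∀ b → (∀ c → HSValue c → b ≤ c) → b ≤ opt)

-- A t-partial vertex cover with t ≥ 1 is nonempty, so m ≥ 1, and it suffices to show that
-- the SDP optimum of the star is exactly t/n.  Write xᵢ = v₀·vᵢ and yₑ = v_centre·v_leaf(e).
-- Lower bound: the second edge constraint gives 3 + x_centre + x_leaf − yₑ ≤ 2(1 + x_centre)
-- + 2(1 + x_leaf); summed over the n edges, and since 1 + xᵢ ≥ 0 for unit vectors, the demand
-- constraint yields 4t ≤ 4n · objective.  Upper bound: put all leaves at −v₀ and the centre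
-- at cosine 2t/n − 1 with v₀ (possible as t ≤ n); the objective is then t/n.

module Submission where

open import Defs
open import Level using (0ℓ)
open import Data.Nat using (ℕ; zero; suc; z≤n; s≤s)
import Data.Nat as ℕ
import Data.Nat.Properties as ℕ
open import Data.Bool using (Bool; false; _∨_)
open import Data.Fin using (Fin; fromℕ; inject₁; _≟_)
open import Data.Fin.Properties using (fromℕ≢inject₁)
open import Data.Fin.Subset using (Subset; ⊥; ∣_∣; outside)
open import Data.Vec using (_∷_; [])
open import Data.Vec.Properties using (lookup-replicate)
open import Data.Product using (_×_; _,_; ∃; proj₁; proj₂)
open import Relation.Binary.PropositionalEquality
  using (_≡_; refl; sym; trans; cong; cong₂; subst; subst₂; module ≡-Reasoning)
open import Relation.Nullary using (¬_; yes; no; contradiction)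
open import Data.Sum using (inj₁; inj₂)
open import Algebra.Bundles using (CommutativeRing)
import Algebra.Properties.Ring as RingProperties
open import Relation.Binary.Bundles using (Poset)
import Relation.Binary.Reasoning.PartialOrder as ≤-Reasoning
open import Relation.Binary.Structures using (IsTotalOrder)

countFin-false : ∀ m (p : Fin m → Bool) → (∀ k → p k ≡ false) → countFin m p ≡ 0
countFin-false zero    p p≡false = refl
countFin-false (suc m) p p≡false rewrite p≡false Fin.zero =
  countFin-false m (λ k → p (Fin.suc k)) (λ k → p≡false (Fin.suc k))

∣p∣≡0⇒p≡⊥ : ∀ {n} {p : Subset n} → ∣ p ∣ ≡ 0 → p ≡ ⊥
∣p∣≡0⇒p≡⊥ {p = []}          _     = refl
∣p∣≡0⇒p≡⊥ {p = outside ∷ p} ∣p∣≡0 = cong (outside ∷_) (∣p∣≡0⇒p≡⊥ ∣p∣≡0)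

hits-⊥ : ∀ G e → hits G ⊥ e ≡ false
hits-⊥ G e with ends G e
... | i , j = cong₂ _∨_ (lookup-replicate i outside) (lookup-replicate j outside)

covered-⊥ : ∀ G → covered G ⊥ ≡ 0
covered-⊥ G = countFin-false (nE G) (hits G ⊥) (hits-⊥ G)

partialVC-nonempty : ∀ {G t} (S : Subset (nV G)) → 1 ℕ.≤ t → IsPartialVC G t S → 1 ℕ.≤ ∣ S ∣
partialVC-nonempty {G} {t} S 1≤t t≤covered with ∣ S ∣ in ∣S∣≡
... | suc _ = s≤s z≤n
... | zero  = contradiction t≤0 (ℕ.<⇒≱ 1≤t)
  where
  t≤0 : t ℕ.≤ 0
  t≤0 = subst (t ℕ.≤_) (trans (cong (covered G) (∣p∣≡0⇒p≡⊥ {p = S} ∣S∣≡)) (covered-⊥ G))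
              t≤covered

module OrderedFieldProperties (ℝ : RealField) where

  open RealField ℝ public renaming (+-mono-≤ to +-monoˡ-≤)
  open IsTotalOrder isTotalOrder public
    using (total; antisym)
    renaming (refl to ≤-refl; trans to ≤-trans; reflexive to ≤-reflexive)

  commutativeRing : CommutativeRing 0ℓ 0ℓ
  commutativeRing = record { isCommutativeRing = isCommutativeRing }

  open CommutativeRing commutativeRing public
    using ( +-assoc; +-comm; +-identityˡ; +-identityʳ; -‿inverseˡ; -‿inverseʳ
          ; *-assoc; *-comm; *-identityˡ; *-identityʳ; zeroˡ; zeroʳ
          ; distribˡ; distribʳ; commutativeSemiring)
  open RingProperties (CommutativeRing.ring commutativeRing) public
    using (-‿involutive; -‿distribˡ-*; -‿distribʳ-*; -1*x≈-x; xyx⁻¹≈y)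

  open import Algebra.Properties.Semiring.Sum (CommutativeRing.semiring commutativeRing) public
    using (sum; sum-cong-≗; ∑-distrib-+; sum-init-last)

  open import Algebra.Solver.Ring.NaturalCoefficients.Default commutativeSemiring public
    using (Polynomial; solve; _:+_; _:*_; _:=_; con)

  -- Denotes exactly fromℕ' k, which the solver's own numerals (k × 1#) do not.
  :fromℕ' : ∀ {m} → ℕ → Polynomial m
  :fromℕ' zero    = con 0
  :fromℕ' (suc k) = con 1 :+ :fromℕ' k

  poset : Poset 0ℓ 0ℓ 0ℓ
  poset = record { isPartialOrder = IsTotalOrder.isPartialOrder isTotalOrder }

  +-monoʳ-≤ : ∀ {x y} z → x ≤ y → z + x ≤ z + y
  +-monoʳ-≤ {x} {y} z x≤y = subst₂ _≤_ (+-comm x z) (+-comm y z) (+-monoˡ-≤ z x≤y)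

  +-mono-≤ : ∀ {x y u v} → x ≤ y → u ≤ v → x + u ≤ y + v
  +-mono-≤ {y = y} {u} x≤y u≤v = ≤-trans (+-monoˡ-≤ u x≤y) (+-monoʳ-≤ y u≤v)

  +-nonneg : ∀ {x y} → 0# ≤ x → 0# ≤ y → 0# ≤ x + y
  +-nonneg {x} {y} 0≤x 0≤y = subst (_≤ x + y) (+-identityʳ 0#) (+-mono-≤ 0≤x 0≤y)

  x≤x+y : ∀ x {y} → 0# ≤ y → x ≤ x + y
  x≤x+y x 0≤y = subst (_≤ x + _) (+-identityʳ x) (+-monoʳ-≤ x 0≤y)

  x≤y⇒0≤y-x : ∀ {x y} → x ≤ y → 0# ≤ y - x
  x≤y⇒0≤y-x {x} {y} x≤y = subst (_≤ y - x) (-‿inverseʳ x) (+-monoˡ-≤ (- x) x≤y)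

  0≤y-x⇒x≤y : ∀ {x y} → 0# ≤ y - x → x ≤ y
  0≤y-x⇒x≤y {x} {y} 0≤y-x = subst₂ _≤_ (+-identityˡ x) y-x+x≡y (+-monoˡ-≤ x 0≤y-x)
    where
    y-x+x≡y : y - x + x ≡ y
    y-x+x≡y = trans (+-assoc y (- x) x) (trans (cong (y +_) (-‿inverseˡ x)) (+-identityʳ y))

  x≤0⇒0≤-x : ∀ {x} → x ≤ 0# → 0# ≤ - x
  x≤0⇒0≤-x {x} x≤0 = subst (0# ≤_) (+-identityˡ (- x)) (x≤y⇒0≤y-x x≤0)

  0≤x*x : ∀ x → 0# ≤ x * x
  0≤x*x x with total 0# x
  ... | inj₁ 0≤x = *-nonneg 0≤x 0≤x
  ... | inj₂ x≤0 = subst (0# ≤_) -x*-x≡x*x (*-nonneg (x≤0⇒0≤-x x≤0) (x≤0⇒0≤-x x≤0))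
    where
    -x*-x≡x*x : - x * - x ≡ x * x
    -x*-x≡x*x = trans (sym (-‿distribˡ-* x (- x)))
                  (trans (cong -_ (sym (-‿distribʳ-* x x))) (-‿involutive (x * x)))

  0≤1 : 0# ≤ 1#
  0≤1 = subst (0# ≤_) (*-identityˡ 1#) (0≤x*x 1#)

  0≤x+x⇒0≤x : ∀ {x} → 0# ≤ x + x → 0# ≤ x
  0≤x+x⇒0≤x {x} 0≤x+x with total 0# x
  ... | inj₁ 0≤x = 0≤x
  ... | inj₂ x≤0 = ≤-trans 0≤x+x (subst (x + x ≤_) (+-identityʳ x) (+-monoʳ-≤ x x≤0))

  *-monoʳ-≤-nonneg : ∀ {x y z} → 0# ≤ z → x ≤ y → z * x ≤ z * y
  *-monoʳ-≤-nonneg {x} {y} {z} 0≤z x≤y =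
    0≤y-x⇒x≤y (subst (0# ≤_) z[y-x]≡zy-zx (*-nonneg 0≤z (x≤y⇒0≤y-x x≤y)))
    where
    z[y-x]≡zy-zx : z * (y - x) ≡ z * y - z * x
    z[y-x]≡zy-zx = trans (distribˡ z y (- x)) (cong (z * y +_) (sym (-‿distribʳ-* z x)))

  ¬0≤-1 : ¬ (0# ≤ - 1#)
  ¬0≤-1 0≤-1 = 0≢1 (antisym 0≤1 1≤0)
    where
    1≤0 : 1# ≤ 0#
    1≤0 = 0≤y-x⇒x≤y (subst (0# ≤_) (sym (+-identityˡ (- 1#))) 0≤-1)

  inverse-nonneg : ∀ {x y} → 0# ≤ x → x * y ≡ 1# → 0# ≤ y
  inverse-nonneg {x} {y} 0≤x xy≡1 with total 0# y
  ... | inj₁ 0≤y = 0≤y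
  ... | inj₂ y≤0 = contradiction 0≤-1 ¬0≤-1
    where
    0≤-1 : 0# ≤ - 1#
    0≤-1 = subst (0# ≤_) (trans (sym (-‿distribʳ-* x y)) (cong -_ xy≡1))
                 (*-nonneg 0≤x (x≤0⇒0≤-x y≤0))

  0<x⇒invertible : ∀ {x} → 0# < x → ∃ λ x⁻¹ → x * x⁻¹ ≡ 1#
  0<x⇒invertible {x} (_ , 0≢x) = inverse x (λ x≡0 → 0≢x (sym x≡0))

  *-cancelˡ-≤-pos : ∀ {x y z} → 0# < z → z * x ≤ z * y → x ≤ y
  *-cancelˡ-≤-pos {x} {y} {z} 0<z zx≤zy =
    subst₂ _≤_ (z⁻¹*[z*w]≡w x) (z⁻¹*[z*w]≡w y)
      (*-monoʳ-≤-nonneg (inverse-nonneg (proj₁ 0<z) zz⁻¹≡1) zx≤zy)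
    where
    z⁻¹ : R
    z⁻¹ = proj₁ (0<x⇒invertible 0<z)
    zz⁻¹≡1 : z * z⁻¹ ≡ 1#
    zz⁻¹≡1 = proj₂ (0<x⇒invertible 0<z)
    z⁻¹*[z*w]≡w : ∀ w → z⁻¹ * (z * w) ≡ w
    z⁻¹*[z*w]≡w w = trans (sym (*-assoc z⁻¹ z w))
                     (trans (cong (_* w) (trans (*-comm z⁻¹ z) zz⁻¹≡1)) (*-identityˡ w))

  quotient : ∀ {z} → 0# < z → ∀ x → ∃ λ y → z * y ≡ x
  quotient {z} 0<z x = z⁻¹ * x , (begin
      z * (z⁻¹ * x)    ≡⟨ sym (*-assoc z z⁻¹ x) ⟩
      z * z⁻¹ * x      ≡⟨ cong (_* x) zz⁻¹≡1 ⟩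
      1# * x           ≡⟨ *-identityˡ x ⟩
      x                ∎)
    where
    open ≡-Reasoning
    z⁻¹ : R
    z⁻¹ = proj₁ (0<x⇒invertible 0<z)
    zz⁻¹≡1 : z * z⁻¹ ≡ 1#
    zz⁻¹≡1 = proj₂ (0<x⇒invertible 0<z)

  0≤fromℕ' : ∀ n → 0# ≤ fromℕ' n
  0≤fromℕ' zero    = ≤-refl
  0≤fromℕ' (suc n) = +-nonneg 0≤1 (0≤fromℕ' n)

  fromℕ'-mono-≤ : ∀ {m n} → m ℕ.≤ n → fromℕ' m ≤ fromℕ' n
  fromℕ'-mono-≤ {n = n} z≤n = 0≤fromℕ' n
  fromℕ'-mono-≤ (s≤s m≤n)   = +-monoʳ-≤ 1# (fromℕ'-mono-≤ m≤n)

  1≤fromℕ' : ∀ {n} → 1 ℕ.≤ n → 1# ≤ fromℕ' n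
  1≤fromℕ' {n} 1≤n = subst (_≤ fromℕ' n) (+-identityʳ 1#) (fromℕ'-mono-≤ 1≤n)

  0<fromℕ' : ∀ {n} → 1 ℕ.≤ n → 0# < fromℕ' n
  0<fromℕ' {n} 1≤n =
    0≤fromℕ' n , λ 0≡n → 0≢1 (antisym 0≤1 (subst (1# ≤_) (sym 0≡n) (1≤fromℕ' 1≤n)))

  sumFin≡sum : ∀ m (f : Fin m → R) → sumFin m f ≡ sum f
  sumFin≡sum zero    f = refl
  sumFin≡sum (suc m) f = cong (f Fin.zero +_) (sumFin≡sum m (λ k → f (Fin.suc k)))

  sumFin-cong : ∀ m {f g : Fin m → R} → (∀ k → f k ≡ g k) → sumFin m f ≡ sumFin m g
  sumFin-cong m {f} {g} f≗g =
    trans (sumFin≡sum m f) (trans (sum-cong-≗ f≗g) (sym (sumFin≡sum m g)))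

  sumFin-+ : ∀ m (f g : Fin m → R) → sumFin m (λ k → f k + g k) ≡ sumFin m f + sumFin m g
  sumFin-+ m f g = trans (sumFin≡sum m _)
    (trans (∑-distrib-+ f g) (sym (cong₂ _+_ (sumFin≡sum m f) (sumFin≡sum m g))))

  sumFin-init-last : ∀ m (f : Fin (suc m) → R) →
                     sumFin (suc m) f ≡ sumFin m (λ k → f (inject₁ k)) + f (fromℕ m)
  sumFin-init-last m f = trans (sumFin≡sum (suc m) f)
    (trans (sum-init-last f) (cong (_+ f (fromℕ m)) (sym (sumFin≡sum m _))))

  sumFin-const : ∀ m x → sumFin m (λ _ → x) ≡ fromℕ' m * x
  sumFin-const zero    x = sym (zeroˡ x)
  sumFin-const (suc m) x =
    trans (cong₂ _+_ (sym (*-identityˡ x)) (sumFin-const m x)) (sym (distribʳ x 1# (fromℕ' m)))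

  sumFin-0 : ∀ m → sumFin m (λ _ → 0#) ≡ 0#
  sumFin-0 m = trans (sumFin-const m 0#) (zeroʳ (fromℕ' m))

  sumFin-mono-≤ : ∀ m {f g : Fin m → R} → (∀ k → f k ≤ g k) → sumFin m f ≤ sumFin m g
  sumFin-mono-≤ zero    f≤g = ≤-refl
  sumFin-mono-≤ (suc m) f≤g = +-mono-≤ (f≤g Fin.zero) (sumFin-mono-≤ m (λ k → f≤g (Fin.suc k)))

  sumFin-nonneg : ∀ m {f : Fin m → R} → (∀ k → 0# ≤ f k) → 0# ≤ sumFin m f
  sumFin-nonneg m {f} 0≤f = subst (_≤ sumFin m f) (sumFin-0 m) (sumFin-mono-≤ m 0≤f)

  unit⇒0≤1+u·w : ∀ {d} (u w : Vect d) → u · u ≡ 1# → w · w ≡ 1# → 0# ≤ 1# + u · w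
  unit⇒0≤1+u·w {d} u w u·u≡1 w·w≡1 =
    0≤x+x⇒0≤x (subst (0# ≤_) ∣u+w∣²≡ (sumFin-nonneg d (λ j → 0≤x*x (u j + w j))))
    where
    open ≡-Reasoning
    ∣u+w∣²≡ : sumFin d (λ j → (u j + w j) * (u j + w j)) ≡ (1# + u · w) + (1# + u · w)
    ∣u+w∣²≡ = begin
      sumFin d (λ j → (u j + w j) * (u j + w j))
        ≡⟨ sumFin-cong d (λ j → solve 2 (λ a b →
             (a :+ b) :* (a :+ b) := (a :* a :+ b :* b) :+ (a :* b :+ a :* b)) refl (u j) (w j)) ⟩
      sumFin d (λ j → (u j * u j + w j * w j) + (u j * w j + u j * w j))
        ≡⟨ sumFin-+ d _ _ ⟩
      sumFin d (λ j → u j * u j + w j * w j) + sumFin d (λ j → u j * w j + u j * w j)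
        ≡⟨ cong₂ _+_ (sumFin-+ d _ _) (sumFin-+ d _ _) ⟩
      (u · u + w · w) + (u · w + u · w)
        ≡⟨ cong (_+ (u · w + u · w)) (cong₂ _+_ u·u≡1 w·w≡1) ⟩
      (1# + 1#) + (u · w + u · w)
        ≡⟨ solve 2 (λ o x → (o :+ o) :+ (x :+ x) := (o :+ x) :+ (o :+ x)) refl 1# (u · w) ⟩
      (1# + u · w) + (1# + u · w) ∎

  plane : ∀ {d} → R → R → Vect (suc (suc d))
  plane x y Fin.zero                = x
  plane x y (Fin.suc Fin.zero)      = y
  plane x y (Fin.suc (Fin.suc _))   = 0#

  plane-· : ∀ {d} x y x′ y′ → plane {d} x y · plane x′ y′ ≡ x * x′ + y * y′
  plane-· {d} x y x′ y′ =
    cong (x * x′ +_) (trans (cong (y * y′ +_) rest≡0) (+-identityʳ (y * y′)))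
    where
    rest≡0 : sumFin d (λ _ → 0# * 0#) ≡ 0#
    rest≡0 = trans (sumFin-cong d (λ _ → zeroˡ 0#)) (sumFin-0 d)

  e₁-· : ∀ {d} x y → plane {d} 1# 0# · plane x y ≡ x
  e₁-· {d} x y = trans (plane-· {d} 1# 0# x y)
    (trans (cong₂ _+_ (*-identityˡ x) (zeroˡ y)) (+-identityʳ x))

  ·-neg-e₁ : ∀ {d} x y → plane {d} x y · plane (- 1#) 0# ≡ - x
  ·-neg-e₁ {d} x y = trans (plane-· {d} x y (- 1#) 0#)
    (trans (cong₂ _+_ (trans (sym (-‿distribʳ-* x 1#)) (cong -_ (*-identityʳ x))) (zeroʳ y))
           (+-identityʳ (- x)))

  x≤x*y : ∀ {x y} → 0# ≤ x → 1# ≤ y → x ≤ x * y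
  x≤x*y {x} {y} 0≤x 1≤y = subst (_≤ x * y) (*-identityʳ x) (*-monoʳ-≤-nonneg 0≤x 1≤y)

  0<z*x⇒0<x : ∀ {x z} → 0# < z → 0# < (z * x) → 0# < x
  0<z*x⇒0<x {x} {z} 0<z (0≤zx , 0≢zx) =
    *-cancelˡ-≤-pos 0<z (subst (_≤ z * x) (sym (zeroʳ z)) 0≤zx) ,
    λ 0≡x → 0≢zx (trans (sym (zeroʳ z)) (cong (z *_) 0≡x))

module StarSDP (ℝ : RealField) (k t : ℕ) where

  open OrderedFieldProperties ℝ

  n : ℕ
  n = suc k

  N T : R
  N = fromℕ' n
  T = fromℕ' t

  1≤N : 1# ≤ N
  1≤N = 1≤fromℕ' {n} (s≤s z≤n)

  0<N : 0# < N
  0<N = 0<fromℕ' {n} (s≤s z≤n)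

  centre : Fin (suc n)
  centre = fromℕ n

  leaf : Fin n → Fin (suc n)
  leaf = inject₁

  demandTerm-bound : ∀ {a b y} → - 1# ≤ a + b + y →
             fromℕ' 3 + a + b - y ≤ ((1# + a) + (1# + a)) + ((1# + b) + (1# + b))
  demandTerm-bound {a} {b} {y} -1≤a+b+y = begin
    fromℕ' 3 + a + b - y                               ≤⟨ x≤x+y _ 0≤a+b+y+1 ⟩
    fromℕ' 3 + a + b - y + (a + b + y + 1#)            ≡⟨ solve 4 (λ a b y -y →
        :fromℕ' 3 :+ a :+ b :+ -y :+ (a :+ b :+ y :+ con 1)
          := (con 1 :+ a :+ (con 1 :+ a)) :+ (con 1 :+ b :+ (con 1 :+ b)) :+ (y :+ -y)) refl a b y (- y) ⟩
    ((1# + a) + (1# + a)) + ((1# + b) + (1# + b)) + (y - y)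
                                                       ≡⟨ cong (_ +_) (-‿inverseʳ y) ⟩
    ((1# + a) + (1# + a)) + ((1# + b) + (1# + b)) + 0#  ≡⟨ +-identityʳ _ ⟩
    ((1# + a) + (1# + a)) + ((1# + b) + (1# + b))      ∎
    where
    open ≤-Reasoning poset
    0≤a+b+y+1 : 0# ≤ a + b + y + 1#
    0≤a+b+y+1 = subst (λ z → 0# ≤ a + b + y + z) (-‿involutive 1#) (x≤y⇒0≤y-x -1≤a+b+y)

  value⇒T≤N*c : ∀ {c} → HSValue (star n) t c → T ≤ N * c
  value⇒T≤N*c {c} (s , 2c≡objective) = *-cancelˡ-≤-pos (0<fromℕ' {4} (s≤s z≤n)) (begin
    fromℕ' 4 * T                                  ≤⟨ demand ⟩
    sumFin n (λ e → fromℕ' 3 + x centre + x (leaf e) - y e)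
                                                  ≤⟨ sumFin-mono-≤ n (λ e → demandTerm-bound (edge₂ e)) ⟩
    sumFin n (λ e → (p + p) + (q e + q e))        ≡⟨ sumFin-+ n (λ _ → p + p) (λ e → q e + q e) ⟩
    sumFin n (λ _ → p + p) + sumFin n (λ e → q e + q e)
                                                  ≡⟨ cong₂ _+_ (sumFin-const n (p + p)) (sumFin-+ n q q) ⟩
    N * (p + p) + (L + L)                         ≤⟨ +-monoʳ-≤ _ (x≤x*y 0≤L+L 1≤N) ⟩
    N * (p + p) + (L + L) * N                     ≡⟨ solve 3 (λ N p L →
        N :* (p :+ p) :+ (L :+ L) :* N := N :* (:fromℕ' 2 :* (L :+ p))) refl N p L ⟩
    N * (fromℕ' 2 * (L + p))                      ≡⟨ cong (λ z → N * (fromℕ' 2 * z)) (sym 2c≡L+p) ⟩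
    N * (fromℕ' 2 * (fromℕ' 2 * c))               ≡⟨ solve 2 (λ N c →
        N :* (:fromℕ' 2 :* (:fromℕ' 2 :* c)) := :fromℕ' 4 :* (N :* c)) refl N c ⟩
    fromℕ' 4 * (N * c)                            ∎)
    where
    open HSFeasible s
    open ≤-Reasoning poset
    x : Fin (suc n) → R
    x i = v0 · v i
    y : Fin n → R
    y e = v centre · v (leaf e)
    p : R
    p = 1# + x centre
    q : Fin n → R
    q e = 1# + x (leaf e)
    L : R
    L = sumFin n q
    0≤L : 0# ≤ L
    0≤L = sumFin-nonneg n (λ e → unit⇒0≤1+u·w v0 (v (leaf e)) unit0 (unit (leaf e)))
    0≤L+L : 0# ≤ L + L
    0≤L+L = +-nonneg 0≤L 0≤L
    2c≡L+p : fromℕ' 2 * c ≡ L + p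
    2c≡L+p = trans 2c≡objective (sumFin-init-last n (λ i → 1# + x i))

  module Witness {c} (0≤c : 0# ≤ c) (c≤1 : c ≤ 1#) where

    a : R
    a = c + c - 1#

    β : R
    β = fromℕ' 4 * (c * (1# - c))

    0≤β : 0# ≤ β
    0≤β = *-nonneg (0≤fromℕ' 4) (*-nonneg 0≤c (x≤y⇒0≤y-x c≤1))

    b : R
    b = proj₁ (sqrt β 0≤β)

    b*b≡β : b * b ≡ β
    b*b≡β = proj₂ (sqrt β 0≤β)

    a≤1 : a ≤ 1#
    a≤1 = begin
      c + c - 1#         ≤⟨ +-monoˡ-≤ (- 1#) (+-mono-≤ c≤1 c≤1) ⟩
      1# + 1# - 1#       ≡⟨ +-assoc 1# 1# (- 1#) ⟩
      1# + (1# - 1#)     ≡⟨ cong (1# +_) (-‿inverseʳ 1#) ⟩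
      1# + 0#            ≡⟨ +-identityʳ 1# ⟩
      1#                 ∎
      where open ≤-Reasoning poset

    1+a≡2c : 1# + a ≡ fromℕ' 2 * c
    1+a≡2c = begin
      1# + (c + c - 1#)             ≡⟨ solve 3 (λ c o -o →
                                         o :+ (c :+ c :+ -o) := :fromℕ' 2 :* c :+ (o :+ -o))
                                         refl c 1# (- 1#) ⟩
      fromℕ' 2 * c + (1# - 1#)      ≡⟨ cong (fromℕ' 2 * c +_) (-‿inverseʳ 1#) ⟩
      fromℕ' 2 * c + 0#             ≡⟨ +-identityʳ _ ⟩
      fromℕ' 2 * c                  ∎
      where open ≡-Reasoning

    a*a+b*b≡1 : a * a + b * b ≡ 1#
    a*a+b*b≡1 = begin
      a * a + b * b                 ≡⟨ cong (a * a +_) b*b≡β ⟩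
      a * a + β                     ≡⟨ solve 3 (λ c -c -o →
          (c :+ c :+ -o) :* (c :+ c :+ -o) :+ :fromℕ' 4 :* (c :* (con 1 :+ -c))
            := :fromℕ' 4 :* c :* (c :+ -c) :+ :fromℕ' 4 :* c :* (con 1 :+ -o) :+ -o :* -o)
          refl c (- c) (- 1#) ⟩
      fromℕ' 4 * c * (c - c) + fromℕ' 4 * c * (1# - 1#) + - 1# * - 1#
        ≡⟨ cong₂ (λ u w → fromℕ' 4 * c * u + fromℕ' 4 * c * w + - 1# * - 1#)
                 (-‿inverseʳ c) (-‿inverseʳ 1#) ⟩
      fromℕ' 4 * c * 0# + fromℕ' 4 * c * 0# + - 1# * - 1#
        ≡⟨ cong₂ (λ u w → u + u + w) (zeroʳ _) (trans (-1*x≈-x (- 1#)) (-‿involutive 1#)) ⟩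
      0# + 0# + 1#                  ≡⟨ trans (cong (_+ 1#) (+-identityʳ 0#)) (+-identityˡ 1#) ⟩
      1#                            ∎
      where open ≡-Reasoning

    u₀ centreVec leafVec : Vect (suc n)
    u₀        = plane 1# 0#
    centreVec = plane a b
    leafVec   = plane (- 1#) 0#

    vertexVec : Fin (suc n) → Vect (suc n)
    vertexVec i with i ≟ centre
    ... | yes _ = centreVec
    ... | no  _ = leafVec

    vertexVec-centre : vertexVec centre ≡ centreVec
    vertexVec-centre with centre ≟ centre
    ... | yes _             = refl
    ... | no  centre≢centre = contradiction refl centre≢centre

    vertexVec-leaf : ∀ e → vertexVec (leaf e) ≡ leafVec
    vertexVec-leaf e with leaf e ≟ centre
    ... | yes leaf≡centre = contradiction (sym leaf≡centre) fromℕ≢inject₁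
    ... | no  _           = refl

    vertexVec-unit : ∀ i → vertexVec i · vertexVec i ≡ 1#
    vertexVec-unit i with i ≟ centre
    ... | yes _ = trans (plane-· {k} a b a b) a*a+b*b≡1
    ... | no  _ = trans (·-neg-e₁ {k} (- 1#) 0#) (-‿involutive 1#)

    edgeProducts : ∀ e → (u₀ · vertexVec centre , u₀ · vertexVec (leaf e) ,
                           vertexVec centre · vertexVec (leaf e)) ≡ (a , - 1# , - a)
    edgeProducts e =
      trans (cong₂ (λ C L → (u₀ · C , u₀ · L , C · L)) vertexVec-centre (vertexVec-leaf e))
            (cong₂ _,_ (e₁-· {k} a b) (cong₂ _,_ (e₁-· {k} (- 1#) 0#) (·-neg-e₁ {k} a b)))

    edgeTerm≡4c : fromℕ' 3 + a + - 1# - - a ≡ fromℕ' 4 * c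
    edgeTerm≡4c = begin
      fromℕ' 3 + a + - 1# - - a             ≡⟨ cong (fromℕ' 3 + a + - 1# +_) (-‿involutive a) ⟩
      fromℕ' 3 + a + - 1# + a               ≡⟨ solve 2 (λ c -o →
          :fromℕ' 3 :+ (c :+ c :+ -o) :+ -o :+ (c :+ c :+ -o)
            := :fromℕ' 4 :* c :+ :fromℕ' 3 :* (con 1 :+ -o)) refl c (- 1#) ⟩
      fromℕ' 4 * c + fromℕ' 3 * (1# - 1#)   ≡⟨ cong (λ z → fromℕ' 4 * c + fromℕ' 3 * z)
                                                    (-‿inverseʳ 1#) ⟩
      fromℕ' 4 * c + fromℕ' 3 * 0#          ≡⟨ cong (fromℕ' 4 * c +_) (zeroʳ (fromℕ' 3)) ⟩
      fromℕ' 4 * c + 0#                     ≡⟨ +-identityʳ _ ⟩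
      fromℕ' 4 * c                          ∎
      where open ≡-Reasoning

    edge₁-holds : a + - 1# - - a ≤ 1#
    edge₁-holds = begin
      a + - 1# - - a      ≡⟨ cong (a + - 1# +_) (-‿involutive a) ⟩
      a + - 1# + a        ≤⟨ +-mono-≤ (+-monoˡ-≤ (- 1#) a≤1) a≤1 ⟩
      1# + - 1# + 1#      ≡⟨ cong (_+ 1#) (-‿inverseʳ 1#) ⟩
      0# + 1#             ≡⟨ +-identityˡ 1# ⟩
      1#                  ∎
      where open ≤-Reasoning poset

    solution : T ≤ N * c → HSFeasible (star n) t
    solution T≤Nc = record
      { v0     = u₀
      ; v      = vertexVec
      ; unit0  = e₁-· {k} 1# 0#
      ; unit   = vertexVec-unit
      ; edge₁  = λ e → subst (λ (x , x′ , y) → x + x′ - y ≤ 1#) (sym (edgeProducts e)) edge₁-holds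
      ; edge₂  = λ e → subst (λ (x , x′ , y) → - 1# ≤ x + x′ + y) (sym (edgeProducts e))
                             (≤-reflexive (sym (xyx⁻¹≈y a (- 1#))))
      ; demand = begin
          fromℕ' 4 * T                   ≤⟨ *-monoʳ-≤-nonneg (0≤fromℕ' 4) T≤Nc ⟩
          fromℕ' 4 * (N * c)             ≡⟨ solve 2 (λ N c →
                                              :fromℕ' 4 :* (N :* c) := N :* (:fromℕ' 4 :* c))
                                              refl N c ⟩
          N * (fromℕ' 4 * c)             ≡⟨ sym (sumFin-const n (fromℕ' 4 * c)) ⟩
          sumFin n (λ _ → fromℕ' 4 * c)  ≡⟨ sumFin-cong n (λ e → sym (edgeTerm e)) ⟩
          sumFin n (λ e → fromℕ' 3 + u₀ · vertexVec centre + u₀ · vertexVec (leaf e)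
                          - vertexVec centre · vertexVec (leaf e)) ∎
      }
      where
      open ≤-Reasoning poset
      edgeTerm : ∀ e → fromℕ' 3 + u₀ · vertexVec centre + u₀ · vertexVec (leaf e)
                         - vertexVec centre · vertexVec (leaf e) ≡ fromℕ' 4 * c
      edgeTerm e = trans (cong (λ (x , x′ , y) → fromℕ' 3 + x + x′ - y) (edgeProducts e)) edgeTerm≡4c

    objective≡2c : sumFin (suc n) (λ i → 1# + u₀ · vertexVec i) ≡ fromℕ' 2 * c
    objective≡2c = begin
      sumFin (suc n) (λ i → 1# + u₀ · vertexVec i)
        ≡⟨ sumFin-init-last n (λ i → 1# + u₀ · vertexVec i) ⟩
      sumFin n (λ e → 1# + u₀ · vertexVec (leaf e)) + (1# + u₀ · vertexVec centre)
        ≡⟨ cong₂ _+_ (sumFin-cong n leafTerm≡0) (cong (λ C → 1# + u₀ · C) vertexVec-centre) ⟩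
      sumFin n (λ _ → 0#) + (1# + u₀ · centreVec)
        ≡⟨ cong₂ _+_ (sumFin-0 n) (cong (1# +_) (e₁-· {k} a b)) ⟩
      0# + (1# + a)                 ≡⟨ +-identityˡ _ ⟩
      1# + a                        ≡⟨ 1+a≡2c ⟩
      fromℕ' 2 * c                  ∎
      where
      open ≡-Reasoning
      leafTerm≡0 : ∀ e → 1# + u₀ · vertexVec (leaf e) ≡ 0#
      leafTerm≡0 e = trans (cong (λ L → 1# + u₀ · L) (vertexVec-leaf e))
                           (trans (cong (1# +_) (e₁-· {k} (- 1#) 0#)) (-‿inverseʳ 1#))

  T≤N*c⇒value : ∀ {c} → 0# ≤ c → c ≤ 1# → T ≤ N * c → HSValue (star n) t c
  T≤N*c⇒value 0≤c c≤1 T≤Nc = solution T≤Nc , sym objective≡2c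
    where open Witness 0≤c c≤1

  IsHSOpt⇒N*opt≡T : ∀ {opt} → t ℕ.≤ n → IsHSOpt (star n) t opt → N * opt ≡ T
  IsHSOpt⇒N*opt≡T {opt} t≤n (opt≤values , lowerBound≤opt) = antisym N*opt≤T T≤N*opt
    where
    0≤N : 0# ≤ N
    0≤N = proj₁ 0<N
    c₀ : R
    c₀ = proj₁ (quotient 0<N T)
    N*c₀≡T : N * c₀ ≡ T
    N*c₀≡T = proj₂ (quotient 0<N T)
    0≤c₀ : 0# ≤ c₀
    0≤c₀ = *-cancelˡ-≤-pos 0<N (subst₂ _≤_ (sym (zeroʳ N)) (sym N*c₀≡T) (0≤fromℕ' t))
    c₀≤1 : c₀ ≤ 1#
    c₀≤1 = *-cancelˡ-≤-pos 0<N
             (subst₂ _≤_ (sym N*c₀≡T) (sym (*-identityʳ N)) (fromℕ'-mono-≤ t≤n))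
    c₀≤values : ∀ c → HSValue (star n) t c → c₀ ≤ c
    c₀≤values c value = *-cancelˡ-≤-pos 0<N (subst (_≤ N * c) (sym N*c₀≡T) (value⇒T≤N*c value))
    N*opt≤T : N * opt ≤ T
    N*opt≤T = subst (N * opt ≤_) N*c₀≡T (*-monoʳ-≤-nonneg 0≤N (opt≤values c₀ value₀))
      where
      value₀ : HSValue (star n) t c₀
      value₀ = T≤N*c⇒value 0≤c₀ c₀≤1 (≤-reflexive (sym N*c₀≡T))
    T≤N*opt : T ≤ N * opt
    T≤N*opt = subst (_≤ N * opt) N*c₀≡T (*-monoʳ-≤-nonneg 0≤N (lowerBound≤opt c₀ c₀≤values))

  integralityGap-bound : ∀ {m opt} → 1 ℕ.≤ t → t ℕ.≤ n → 1 ℕ.≤ m → IsHSOpt (star n) t opt →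
                         0# < opt × N * opt ≤ T * fromℕ' m
  integralityGap-bound {m} {opt} 1≤t t≤n 1≤m isOpt =
    0<z*x⇒0<x 0<N (subst (0# <_) (sym N*opt≡T) (0<fromℕ' 1≤t)) ,
    subst (_≤ T * fromℕ' m) (sym N*opt≡T) (x≤x*y (0≤fromℕ' t) (1≤fromℕ' 1≤m))
    where
    N*opt≡T : N * opt ≡ T
    N*opt≡T = IsHSOpt⇒N*opt≡T t≤n isOpt

open import Data.Nat using (_≤_; _*_)

proposition1 : (ℝ : RealField) → (n t : ℕ) → 1 ≤ n → 1 ≤ t → 2 * t ≤ n →
    (m : ℕ) → (opt : RealField.R ℝ) →
    IsMinPartialVC (star n) t m → RealField.IsHSOpt ℝ (star n) t opt →
    RealField._<_ ℝ (RealField.0# ℝ) opt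
    × RealField._≤_ ℝ (RealField._*_ ℝ (RealField.fromℕ' ℝ n) opt)
                      (RealField._*_ ℝ (RealField.fromℕ' ℝ t) (RealField.fromℕ' ℝ m))
proposition1 ℝ zero    t ()
proposition1 ℝ (suc k) t _ 1≤t 2t≤n m opt ((S , S-covers , ∣S∣≡m) , _) =
  StarSDP.integralityGap-bound ℝ k t 1≤t t≤n 1≤m
  where
  t≤n : t ≤ suc k
  t≤n = ℕ.≤-trans (ℕ.m≤m+n t (t ℕ.+ 0)) 2t≤n
  1≤m : 1 ≤ m
  1≤m = subst (1 ≤_) ∣S∣≡m (partialVC-nonempty S 1≤t S-covers)
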